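{- Let $\Sigma_0$ be the signature with a single sort $\sigma$ and no function or predicate symbols other than equality, and let ${\cal T}^\infty_{Even}$ be the $\Sigma_0$-theory of all $\Sigma_0$-structures ${\cal A}$ such that $|\sigma^{\cal A}|$ is even or infinite. Then ${\cal T}^\infty_{Even}$ is finitely witnessable w.r.t. $\sigma$.
   Context: A ${\cal T}$-interpretation is an interpretation whose underlying structure is in ${\cal T}$; formulas are ${\cal T}$-equivalent if satisfied by the same ${\cal T}$-interpretations. $\mathit{vars}_\sigma(\phi)$ is the set of free variables of sort $\sigma$ in $\phi$, $\mathit{vars}(\phi)$ all free variables, $X^{\cal A}=\{x^{\cal A}:x\in X\}$; $QF(\Sigma)$ is the set of quantifier-free $\Sigma$-formulas. For a set $S$ of sorts, a ${\cal T}$-interpretation ${\cal A}$ finitely witnesses $\phi$ for ${\cal T}$ w.r.t. $S$ if ${\cal A}\models\phi$ and $s^{\cal A}=\mathit{vars}_s(\phi)^{\cal A}$ for all $s\in S$; $\phi$ is finitely witnessed if it is ${\cal T}$-unsatisfiable or has such a finite witness. A witness for ${\cal T}$ w.r.t. $S$ is a function $\mathit{wit}:QF(\Sigma)\to QF(\Sigma)$ such that for every $\phi$: $\phi$ and $\exists\vec w.\mathit{wit}(\phi)$ are ${\cal T}$-equivalent, where $\vec w=\mathit{vars}(\mathit{wit}(\phi))\setminus\mathit{vars}(\phi)$, and $\mathit{wit}(\phi)$ is finitely witnessed for ${\cal T}$ w.r.t. $S$. ${\cal T}$ is finitely witnessable w.r.t. $S$ if it has a computable witness. -}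

module Defs where

open import Level using (Level)
open import Data.Nat using (ℕ; _*_)
open import Data.Nat.Properties using (_≟_)
open import Data.Fin using (Fin)
open import Data.List using (List; []; _∷_; _++_; filter)
open import Data.List.Membership.Propositional using (_∈_; _∉_)
open import Data.List.Membership.DecPropositional _≟_ using (_∈?_)
open import Data.Product using (Σ; ∃; _×_; _,_)
open import Data.Sum using (_⊎_)
open import Data.Unit using (⊤)
open import Data.Empty using (⊥)
open import Relation.Nullary using (¬_; ¬?)
open import Relation.Binary.PropositionalEquality using (_≡_)
open import Function.Bundles using (_↔_)

data QF : Set where
  _≐_  : ℕ → ℕ → QF
  ⊤ᶠ   : QF
  ⊥ᶠ   : QF
  ¬ᶠ_  : QF → QF
  _∧ᶠ_ : QF → QF → QF
  _∨ᶠ_ : QF → QF → QF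
  _⇒ᶠ_ : QF → QF → QF

-- free variables (all of sort σ); a list, membership is what matters
vars : QF → List ℕ
vars (x ≐ y)  = x ∷ y ∷ []
vars ⊤ᶠ       = []
vars ⊥ᶠ       = []
vars (¬ᶠ φ)   = vars φ
vars (φ ∧ᶠ ψ) = vars φ ++ vars ψ
vars (φ ∨ᶠ ψ) = vars φ ++ vars ψ
vars (φ ⇒ᶠ ψ) = vars φ ++ vars ψ

-- Σ₀-interpretations: a Σ₀-structure is just the domain σ^A (a set);
-- an interpretation additionally assigns an element to every variable.

record Interp : Set₁ where
  constructor interp
  field
    Carrier : Set
    val     : ℕ → Carrier
open Interp public

_⊨_ : Interp → QF → Set
A ⊨ (x ≐ y)  = val A x ≡ val A y
A ⊨ ⊤ᶠ       = ⊤
A ⊨ ⊥ᶠ       = ⊥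
A ⊨ (¬ᶠ φ)   = ¬ (A ⊨ φ)
A ⊨ (φ ∧ᶠ ψ) = (A ⊨ φ) × (A ⊨ ψ)
A ⊨ (φ ∨ᶠ ψ) = (A ⊨ φ) ⊎ (A ⊨ ψ)
A ⊨ (φ ⇒ᶠ ψ) = (A ⊨ φ) → (A ⊨ ψ)

_⊨∃_∙_ : Interp → List ℕ → QF → Set
A ⊨∃ ws ∙ ψ =
  Σ (ℕ → Carrier A) λ val′ →
    (∀ x → x ∉ ws → val′ x ≡ val A x) × (interp (Carrier A) val′ ⊨ ψ)

Finite : Set → Set
Finite A = Σ ℕ λ n → A ↔ Fin n

EvenOrInfinite : Set → Set
EvenOrInfinite A = (Σ ℕ λ k → A ↔ Fin (2 * k)) ⊎ ¬ Finite A

TInterp : Interp → Set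
TInterp A = EvenOrInfinite (Carrier A)

TUnsat : QF → Set₁
TUnsat φ = ∀ A → TInterp A → ¬ (A ⊨ φ)

FinitelyWitnesses : Interp → QF → Set
FinitelyWitnesses A φ =
  TInterp A × (A ⊨ φ) × (∀ (a : Carrier A) → ∃ λ x → x ∈ vars φ × val A x ≡ a)

FinitelyWitnessed : QF → Set₁
FinitelyWitnessed φ = TUnsat φ ⊎ Σ Interp λ A → FinitelyWitnesses A φ

newVars : QF → QF → List ℕ
newVars φ ψ = filter (λ x → ¬? (x ∈? vars φ)) (vars ψ)

TEquiv∃ : QF → List ℕ → QF → Set₁
TEquiv∃ φ ws ψ =
  ∀ A → TInterp A → ((A ⊨ φ) → (A ⊨∃ ws ∙ ψ)) × ((A ⊨∃ ws ∙ ψ) → (A ⊨ φ))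

IsWitness : (QF → QF) → Set₁
IsWitness wit =
  ∀ φ → TEquiv∃ φ (newVars φ (wit φ)) (wit φ) × FinitelyWitnessed (wit φ)

-- computable witness: an Agda function (all Agda functions are computable)
FinitelyWitnessable : Set₁
FinitelyWitnessable = Σ (QF → QF) IsWitness

module Submission where

-- A quantifier-free Σ₀-formula only sees which of its variables are equal. If φ has n variables,
-- any model of φ can therefore be replaced by one on at most n + 1 elements, so satisfiability
-- of φ is decidable by a finite search. Take wit(φ) = φ ∧ w₁ = w₁ ∧ w₂ = w₂ with w₁, w₂ fresh.
-- If the search fails, wit(φ) is unsatisfiable. Otherwise collapse the model found onto the m
-- values taken by the variables of φ and add one or two new elements, interpreting w₁ and w₂,
-- so that the domain has even size and is covered by the variables of wit(φ). Equality in an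
-- arbitrary model need not be decidable, so the collapse that proves the first claim is only
-- available under double negation; that suffices to refute satisfiability.

open import Defs
open import Data.Nat using (ℕ; zero; suc; _+_; _*_; _≤_; _<_; z≤n; s≤s)
open import Data.Nat.Properties using (_≟_; ≤-trans; ≤-refl; n≤1+n; <⇒≱; *-suc; 1+n≢n)
open import Data.Fin using (Fin; zero; suc; fromℕ; inject≤)
open import Data.Fin.Properties using (suc-injective; inject≤-injective; any?; +↔⊎) renaming (_≟_ to _≟ᶠ_)
open import Data.List using (List; []; _∷_; _++_; length)
open import Data.List.Extrema.Nat using (max; xs≤max)
open import Data.List.Membership.Propositional using (_∈_; _∉_; find; lose)
open import Data.List.Membership.Propositional.Properties using (∈-++⁺ˡ; ∈-++⁺ʳ; ∈-filter⁻; ∈-lookup)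
open import Data.List.Membership.DecPropositional _≟_ using (_∈?_)
open import Data.List.Relation.Unary.Any as Any using (Any; here; there; index)
open import Data.List.Relation.Unary.Any.Properties using (lookup-index)
import Data.List.Relation.Unary.All as All
open import Data.Vec using (Vec; []; _∷_; tabulate)
import Data.Vec as Vec
open import Data.Vec.Properties using (lookup∘tabulate)
open import Data.Product using (Σ; ∃; _×_; _,_; proj₁; proj₂)
open import Data.Product.Function.NonDependent.Propositional using (_×-⇔_)
open import Data.Sum using (_⊎_; inj₁; inj₂)
open import Data.Sum.Properties using (inj₁-injective)
open import Data.Sum.Function.Propositional using (_⊎-⇔_)
open import Data.Unit using (tt)
open import Data.Empty using (⊥-elim)
open import Level using (0ℓ)
open import Relation.Nullary using (¬_; Dec; yes; no; ¬?)
open import Relation.Nullary.Decidable using (_×-dec_; _⊎-dec_; _→-dec_; map′; ¬¬-excluded-middle)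
open import Relation.Nullary.Negation using (¬¬-Monad; ¬¬-map)
open import Relation.Binary.Definitions using (DecidableEquality)
open import Relation.Binary.PropositionalEquality using (_≡_; refl; sym; trans; cong; subst)
open import Function using (_∘_; Injective)
open import Function.Bundles using (_↔_; _⇔_; mk⇔; Equivalence)
open import Function.Properties.Equivalence using () renaming (refl to ⇔-refl; trans to ⇔-trans)
open import Function.Properties.Inverse using (↔-sym)
open import Function.Related.TypeIsomorphisms using (→-cong-⇔; ¬-cong-⇔)

open Equivalence using (to; from)

≡-cong-⇔ : ∀ {A : Set} {a a′ b b′ : A} → a ≡ a′ → b ≡ b′ → (a ≡ b) ⇔ (a′ ≡ b′)
≡-cong-⇔ refl refl = ⇔-refl

injective⇒≡-⇔ : ∀ {A B : Set} {ι : A → B} → Injective _≡_ _≡_ ι → ∀ {a b} → (ι a ≡ ι b) ⇔ (a ≡ b)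
injective⇒≡-⇔ {ι = ι} inj = mk⇔ inj (cong ι)

_≈[_]_ : ∀ {A B : Set} → (ℕ → A) → List ℕ → (ℕ → B) → Set
f ≈[ vs ] g = ∀ {x y} → x ∈ vs → y ∈ vs → (f x ≡ f y) ⇔ (g x ≡ g y)

≈-++ˡ : ∀ {A B : Set} {f : ℕ → A} {g : ℕ → B} {vs} ws → f ≈[ vs ++ ws ] g → f ≈[ vs ] g
≈-++ˡ ws f≈g p q = f≈g (∈-++⁺ˡ p) (∈-++⁺ˡ q)

≈-++ʳ : ∀ {A B : Set} {f : ℕ → A} {g : ℕ → B} vs {ws} → f ≈[ vs ++ ws ] g → f ≈[ ws ] g
≈-++ʳ vs f≈g p q = f≈g (∈-++⁺ʳ vs p) (∈-++⁺ʳ vs q)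

≈-pointwise : ∀ {A : Set} {f g : ℕ → A} {vs} → (∀ {x} → x ∈ vs → f x ≡ g x) → f ≈[ vs ] g
≈-pointwise f≡g p q = ≡-cong-⇔ (f≡g p) (f≡g q)

⊨-cong : ∀ φ {A B} → val A ≈[ vars φ ] val B → (A ⊨ φ) ⇔ (B ⊨ φ)
⊨-cong (x ≐ y)  A≈B = A≈B (here refl) (there (here refl))
⊨-cong ⊤ᶠ       A≈B = ⇔-refl
⊨-cong ⊥ᶠ       A≈B = ⇔-refl
⊨-cong (¬ᶠ φ)   A≈B = ¬-cong-⇔ (⊨-cong φ A≈B)
⊨-cong (φ ∧ᶠ ψ) A≈B = ⊨-cong φ (≈-++ˡ (vars ψ) A≈B) ×-⇔ ⊨-cong ψ (≈-++ʳ (vars φ) A≈B)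
⊨-cong (φ ∨ᶠ ψ) A≈B = ⊨-cong φ (≈-++ˡ (vars ψ) A≈B) ⊎-⇔ ⊨-cong ψ (≈-++ʳ (vars φ) A≈B)
⊨-cong (φ ⇒ᶠ ψ) A≈B = →-cong-⇔ (⊨-cong φ (≈-++ˡ (vars ψ) A≈B)) (⊨-cong ψ (≈-++ʳ (vars φ) A≈B))

⊨-dec : ∀ {A} → DecidableEquality (Carrier A) → ∀ φ → Dec (A ⊨ φ)
⊨-dec {A} _≟ᴬ_ (x ≐ y)  = val A x ≟ᴬ val A y
⊨-dec     _≟ᴬ_ ⊤ᶠ       = yes tt
⊨-dec     _≟ᴬ_ ⊥ᶠ       = no λ ()
⊨-dec     _≟ᴬ_ (¬ᶠ φ)   = ¬? (⊨-dec _≟ᴬ_ φ)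
⊨-dec     _≟ᴬ_ (φ ∧ᶠ ψ) = ⊨-dec _≟ᴬ_ φ ×-dec ⊨-dec _≟ᴬ_ ψ
⊨-dec     _≟ᴬ_ (φ ∨ᶠ ψ) = ⊨-dec _≟ᴬ_ φ ⊎-dec ⊨-dec _≟ᴬ_ ψ
⊨-dec     _≟ᴬ_ (φ ⇒ᶠ ψ) = ⊨-dec _≟ᴬ_ φ →-dec ⊨-dec _≟ᴬ_ ψ

module _ {C : Set} {vs : List ℕ} (c : ∀ {x} → x ∈ vs → C) (d : ℕ → C) where

  extend : ℕ → C
  extend x with x ∈? vs
  ... | yes p = c p
  ... | no _  = d x

  extend-∈ : ∀ {x} → x ∈ vs → ∃ λ (p : x ∈ vs) → extend x ≡ c p
  extend-∈ {x} x∈vs with x ∈? vs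
  ... | yes p   = p , refl
  ... | no x∉vs = ⊥-elim (x∉vs x∈vs)

  extend-∉ : ∀ {x} → x ∉ vs → extend x ≡ d x
  extend-∉ {x} x∉vs with x ∈? vs
  ... | yes x∈vs = ⊥-elim (x∉vs x∈vs)
  ... | no _     = refl

DecidableOn : ∀ {C : Set} → (ℕ → C) → List ℕ → Set
DecidableOn f vs = ∀ {x y} → x ∈ vs → y ∈ vs → Dec (f x ≡ f y)

¬¬-decidableOn : ∀ {C : Set} (f : ℕ → C) vs → ¬ ¬ DecidableOn f vs
¬¬-decidableOn f vs = ¬¬-map (λ table {x} {y} p q → All.lookup (All.lookup table p) q)
  (All.sequenceM 0ℓ ¬¬-Monad (All.tabulate λ _ →
     All.sequenceM 0ℓ ¬¬-Monad (All.tabulate λ _ → ¬¬-excluded-middle)))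

any-∈? : ∀ {P : ℕ → Set} xs → (∀ {x} → x ∈ xs → Dec (P x)) → Dec (Any P xs)
any-∈? []       P? = no λ ()
any-∈? (x ∷ xs) P? = map′ Any.fromSum Any.toSum (P? (here refl) ⊎-dec any-∈? xs (P? ∘ there))

record Compression {C : Set} (f : ℕ → C) (vs : List ℕ) : Set where
  field
    size            : ℕ
    size≤length     : size ≤ length vs
    code            : ∀ {x} → x ∈ vs → Fin size
    code-≡          : ∀ {x y} (p : x ∈ vs) (q : y ∈ vs) → (code p ≡ code q) ⇔ (f x ≡ f y)
    code-surjective : ∀ i → ∃ λ x → Σ (x ∈ vs) λ p → code p ≡ i

  code-cong : ∀ {x y} → x ≡ y → (p : x ∈ vs) (q : y ∈ vs) → code p ≡ code q
  code-cong x≡y p q = from (code-≡ p q) (cong f x≡y)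

  ≈-via-code : ∀ {D : Set} {ι : Fin size → D} → Injective _≡_ _≡_ ι →
               (h : ℕ → D) → (∀ {x} → x ∈ vs → ∃ λ p → h x ≡ ι (code p)) → h ≈[ vs ] f
  ≈-via-code ι-inj h h≡ι∘code x∈vs y∈vs with h≡ι∘code x∈vs | h≡ι∘code y∈vs
  ... | p , hx≡ | q , hy≡ = ⇔-trans (≡-cong-⇔ hx≡ hy≡) (⇔-trans (injective⇒≡-⇔ ι-inj) (code-≡ p q))

open Compression

compress : ∀ {C : Set} (f : ℕ → C) vs → DecidableOn f vs → Compression f vs
compress f []       _   = record
  { size = 0 ; size≤length = z≤n ; code = λ () ; code-≡ = λ () ; code-surjective = λ () }
compress f (v ∷ vs) f?
  with compress f vs (λ p q → f? (there p) (there q))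
     | any-∈? {λ y → f v ≡ f y} vs (λ q → f? (here refl) (there q))
... | c | yes found = record
  { size            = size c
  ; size≤length     = ≤-trans (size≤length c) (n≤1+n _)
  ; code            = code′
  ; code-≡          = code′-≡
  ; code-surjective = λ i → let x , p , eq = code-surjective c i in x , there p , eq
  }
  where
  representative : ∀ {x} → x ∈ v ∷ vs → ∃ λ x′ → x′ ∈ vs × f x ≡ f x′
  representative (here refl) = find found
  representative (there p)   = _ , p , refl

  code′ : ∀ {x} → x ∈ v ∷ vs → Fin (size c)
  code′ p = code c (proj₁ (proj₂ (representative p)))

  code′-≡ : ∀ {x y} (p : x ∈ v ∷ vs) (q : y ∈ v ∷ vs) → (code′ p ≡ code′ q) ⇔ (f x ≡ f y)
  code′-≡ p q =
    let _ , p′ , fx≡ = representative p ; _ , q′ , fy≡ = representative q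
    in ⇔-trans (code-≡ c p′ q′) (≡-cong-⇔ (sym fx≡) (sym fy≡))
... | c | no new = record
  { size            = suc (size c)
  ; size≤length     = s≤s (size≤length c)
  ; code            = code′
  ; code-≡          = code′-≡
  ; code-surjective = code′-surjective
  }
  where
  code′ : ∀ {x} → x ∈ v ∷ vs → Fin (suc (size c))
  code′ (here _)  = zero
  code′ (there p) = suc (code c p)

  code′-≡ : ∀ {x y} (p : x ∈ v ∷ vs) (q : y ∈ v ∷ vs) → (code′ p ≡ code′ q) ⇔ (f x ≡ f y)
  code′-≡ (here refl) (here refl) = mk⇔ (λ _ → refl) (λ _ → refl)
  code′-≡ (here refl) (there q)   = mk⇔ (λ ()) (λ fv≡fy → ⊥-elim (new (lose q fv≡fy)))
  code′-≡ (there p)   (here refl) = mk⇔ (λ ()) (λ fx≡fv → ⊥-elim (new (lose p (sym fx≡fv))))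
  code′-≡ (there p)   (there q)   = ⇔-trans (injective⇒≡-⇔ suc-injective) (code-≡ c p q)

  code′-surjective : ∀ i → ∃ λ x → Σ (x ∈ v ∷ vs) λ p → code′ p ≡ i
  code′-surjective zero    = v , here refl , refl
  code′-surjective (suc i) = let x , p , eq = code-surjective c i in x , there p , cong suc eq

∃-Vec? : ∀ {k} n {P : Vec (Fin k) n → Set} → (∀ ds → Dec (P ds)) → Dec (∃ P)
∃-Vec? zero    P? = map′ ([] ,_) (λ { ([] , p) → p }) (P? [])
∃-Vec? (suc n) P? = map′ (λ { (d , ds , p) → d ∷ ds , p }) (λ { (d ∷ ds , p) → d , ds , p })
                         (any? λ d → ∃-Vec? n (P? ∘ (d ∷_)))

-- The extra element keeps the domain inhabited when vs = [].
Small : (vs : List ℕ) → Vec (Fin (suc (length vs))) (length vs) → Interp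
Small vs ds = interp (Fin (suc (length vs))) (extend {vs = vs} (Vec.lookup ds ∘ index) (λ _ → zero))

small-satisfiable? : ∀ φ → Dec (∃ λ ds → Small (vars φ) ds ⊨ φ)
small-satisfiable? φ = ∃-Vec? _ λ ds → ⊨-dec _≟ᶠ_ φ

small-complete : ∀ {C : Set} {f : ℕ → C} {vs} → DecidableOn f vs → ∃ λ ds → val (Small vs ds) ≈[ vs ] f
small-complete {f = f} {vs} f? = ds , ≈-via-code c (λ {i} {j} → inject≤-injective size≤ size≤ i j) _ small≡code
  where
  c : Compression f vs
  c = compress f vs f?

  size≤ : size c ≤ suc (length vs)
  size≤ = ≤-trans (size≤length c) (n≤1+n _)

  ds : Vec (Fin (suc (length vs))) (length vs)
  ds = tabulate λ i → inject≤ (code c (∈-lookup i)) size≤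

  small≡code : ∀ {x} → x ∈ vs → ∃ λ p → val (Small vs ds) x ≡ inject≤ (code c p) size≤
  small≡code x∈vs with extend-∈ (Vec.lookup ds ∘ index) (λ _ → zero) x∈vs
  ... | p , eq = p , trans eq (trans (lookup∘tabulate _ (index p))
                   (cong (λ i → inject≤ i size≤) (code-cong c (sym (lookup-index p)) _ p)))

small-model : ∀ φ {A} → A ⊨ φ → ¬ ¬ ∃ λ ds → Small (vars φ) ds ⊨ φ
small-model φ {A} A⊨φ = ¬¬-map smaller (¬¬-decidableOn (val A) (vars φ))
  where
  smaller : DecidableOn (val A) (vars φ) → ∃ λ ds → Small (vars φ) ds ⊨ φ
  smaller A? = let ds , Small≈A = small-complete A? in ds , from (⊨-cong φ Small≈A) A⊨φ

record EvenPadding (m : ℕ) : Set where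
  field
    excess   : ℕ
    half     : ℕ
    excess≤1 : excess ≤ 1
    even     : m + suc excess ≡ 2 * half

even-padding : ∀ m → EvenPadding m
even-padding zero          = record { excess = 1 ; half = 1 ; excess≤1 = s≤s z≤n ; even = refl }
even-padding (suc zero)    = record { excess = 0 ; half = 1 ; excess≤1 = z≤n ; even = refl }
even-padding (suc (suc m)) = record
  { excess = excess ; half = suc half ; excess≤1 = excess≤1
  ; even = trans (cong (2 +_) even) (sym (*-suc 2 half)) }
  where open EvenPadding (even-padding m)

padding-covered : ∀ {q} → q ≤ 1 → (r : Fin (suc q)) → r ≡ zero ⊎ r ≡ fromℕ q
padding-covered z≤n       zero       = inj₁ refl
padding-covered (s≤s z≤n) zero       = inj₁ refl
padding-covered (s≤s z≤n) (suc zero) = inj₂ refl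

fresh : ∀ {vs x} → max 0 vs < x → x ∉ vs
fresh {vs} max<x x∈vs = <⇒≱ max<x (All.lookup (xs≤max 0 vs) x∈vs)

module Witness (φ : QF) where

  w₁ w₂ : ℕ
  w₁ = suc (max 0 (vars φ))
  w₂ = suc w₁

  wit : QF
  wit = φ ∧ᶠ ((w₁ ≐ w₁) ∧ᶠ (w₂ ≐ w₂))

  wit-equiv : TEquiv∃ φ (newVars φ wit) wit
  wit-equiv A _ = (λ A⊨φ → val A , (λ _ _ → refl) , A⊨φ , refl , refl) , back
    where
    back : A ⊨∃ newVars φ wit ∙ wit → A ⊨ φ
    back (val′ , agree , A′⊨φ , _) = to (⊨-cong φ (≈-pointwise agree-on-φ)) A′⊨φ
      where
      agree-on-φ : ∀ {x} → x ∈ vars φ → val′ x ≡ val A x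
      agree-on-φ x∈φ = agree _ λ x∈new → proj₂ (∈-filter⁻ (λ y → ¬? (y ∈? vars φ)) {xs = vars wit} x∈new) x∈φ

  module Padded {C : Set} (f : ℕ → C) (f? : DecidableOn f (vars φ)) (f⊨φ : interp C f ⊨ φ) where

    c : Compression f (vars φ)
    c = compress f (vars φ) f?

    open EvenPadding (even-padding (size c))

    padding : ℕ → Fin (size c) ⊎ Fin (suc excess)
    padding x with x ≟ w₂
    ... | yes _ = inj₂ (fromℕ excess)
    ... | no _  = inj₂ zero

    B : Interp
    B = interp (Fin (size c) ⊎ Fin (suc excess)) (extend (inj₁ ∘ code c) padding)

    B-even : TInterp B
    B-even = inj₁ (half , subst (λ n → Carrier B ↔ Fin n) even (↔-sym +↔⊎))

    B⊨φ : B ⊨ φ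
    B⊨φ = from (⊨-cong φ (≈-via-code c inj₁-injective _ (extend-∈ (inj₁ ∘ code c) padding))) f⊨φ

    val-w₁ : val B w₁ ≡ inj₂ zero
    val-w₁ with w₁ ≟ w₂ | extend-∉ (inj₁ ∘ code c) padding (fresh ≤-refl)
    ... | yes w₁≡w₂ | _  = ⊥-elim (1+n≢n (sym w₁≡w₂))
    ... | no _      | eq = eq

    val-w₂ : val B w₂ ≡ inj₂ (fromℕ excess)
    val-w₂ with w₂ ≟ w₂ | extend-∉ (inj₁ ∘ code c) padding (fresh (n≤1+n _))
    ... | yes _    | eq = eq
    ... | no w₂≢w₂ | _  = ⊥-elim (w₂≢w₂ refl)

    B-covered : ∀ a → ∃ λ x → x ∈ vars wit × val B x ≡ a
    B-covered (inj₁ i) with code-surjective c i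
    ... | x , p , code≡i with extend-∈ (inj₁ ∘ code c) padding p
    ...   | p′ , eq = x , ∈-++⁺ˡ p , trans eq (cong inj₁ (trans (code-cong c refl p′ p) code≡i))
    B-covered (inj₂ r) with padding-covered excess≤1 r
    ... | inj₁ refl = w₁ , ∈-++⁺ʳ (vars φ) (here refl) , val-w₁
    ... | inj₂ refl = w₂ , ∈-++⁺ʳ (vars φ) (∈-++⁺ʳ (w₁ ∷ w₁ ∷ []) (here refl)) , val-w₂

    witnessed : FinitelyWitnesses B wit
    witnessed = B-even , (B⊨φ , refl , refl) , B-covered

  wit-finitelyWitnessed : FinitelyWitnessed wit
  wit-finitelyWitnessed with small-satisfiable? φ
  ... | yes (ds , Small⊨φ) = inj₂ (_ , Padded.witnessed (val (Small (vars φ) ds)) (λ _ _ → _≟ᶠ_ _ _) Small⊨φ)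
  ... | no ¬small          = inj₁ λ A _ (A⊨φ , _) → small-model φ A⊨φ ¬small

lemma6 : FinitelyWitnessable
lemma6 = Witness.wit , λ φ → Witness.wit-equiv φ , Witness.wit-finitelyWitnessed φ
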